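{- Let $H$ be a graph obtained from a graph $G$ by repeatedly deleting vertices and/or bridges of the current graph at each stage. (1) If $G$ is a chordal graph then so is $H$. (2) If $G$ is a split graph with split partition $(K,I)$ and at least three vertices of $K$ remain in $H$, then $H$ is a split graph.
   Context: A graph is chordal if every cycle of length at least four has a chord. A split graph is a graph whose vertex set can be partitioned into a clique $K$ (clique side) and an independent set $I$. A bridge is an edge contained in no cycle; deleting a bridge removes only the edge. -}

module Defs where

open import Data.Nat using (ℕ; zero; suc; _≤_)
open import Data.Fin using (Fin; toℕ; _≟_)
open import Data.Bool using (Bool; true; false; _∧_; _∨_; not)
open import Data.Product using (Σ; ∃; _×_; _,_)
open import Data.Sum using (_⊎_)
open import Data.Empty using (⊥)
open import Relation.Nullary using (¬_)
open import Relation.Nullary.Decidable using (⌊_⌋)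
open import Relation.Binary.PropositionalEquality using (_≡_; _≢_)
open import Relation.Binary.Construct.Closure.ReflexiveTransitive using (Star)
open import Function.Definitions using (Injective)

-- Graphs obtained by
-- deleting vertices/edges keep their labels from the original graph.
record Graph (n : ℕ) : Set where
  field
    vtx     : Fin n → Bool
    edge    : Fin n → Fin n → Bool
    sym     : ∀ u v → edge u v ≡ edge v u
    irrefl  : ∀ v → edge v v ≡ false
    edge-vtx : ∀ u v → edge u v ≡ true → vtx u ≡ true
open Graph public

Full : ∀ {n} → Graph n → Set
Full G = ∀ v → vtx G v ≡ true

Consec : ℕ → ℕ → ℕ → Set
Consec k a b = (suc a ≡ b) ⊎ (suc b ≡ a) ⊎ ((a ≡ 0) × (suc b ≡ k)) ⊎ ((b ≡ 0) × (suc a ≡ k))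

record Cycle {n} (G : Graph n) (k : ℕ) : Set where
  field
    len≥3 : 3 ≤ k
    c     : Fin k → Fin n
    inj   : Injective _≡_ _≡_ c
    adj   : ∀ i j → Consec k (toℕ i) (toℕ j) → edge G (c i) (c j) ≡ true
open Cycle public

HasChord : ∀ {n} {G : Graph n} {k} → Cycle G k → Set
HasChord {G = G} {k} C =
  Σ (Fin k) λ i → Σ (Fin k) λ j →
    (i ≢ j) × (¬ Consec k (toℕ i) (toℕ j)) × (edge G (c C i) (c C j) ≡ true)

Chordal : ∀ {n} → Graph n → Set
Chordal G = ∀ k → 4 ≤ k → (C : Cycle G k) → HasChord C

record SplitPartition {n} (G : Graph n) (K I : Fin n → Bool) : Set where
  field
    K-vtx   : ∀ v → K v ≡ true → vtx G v ≡ true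
    I-vtx   : ∀ v → I v ≡ true → vtx G v ≡ true
    cover   : ∀ v → vtx G v ≡ true → (K v ≡ true) ⊎ (I v ≡ true)
    disj    : ∀ v → K v ≡ true → I v ≡ true → ⊥
    clique  : ∀ u v → K u ≡ true → K v ≡ true → u ≢ v → edge G u v ≡ true
    indep   : ∀ u v → I u ≡ true → I v ≡ true → edge G u v ≡ false

Split : ∀ {n} → Graph n → Set
Split G = ∃ λ K → ∃ λ I → SplitPartition G K I

Bridge : ∀ {n} → Graph n → Fin n → Fin n → Set
Bridge G u v = (edge G u v ≡ true) ×
  (∀ k (C : Cycle G k) i j → Consec k (toℕ i) (toℕ j) →
     ¬ (((c C i ≡ u) × (c C j ≡ v)) ⊎ ((c C i ≡ v) × (c C j ≡ u))))

eqb : ∀ {n} → Fin n → Fin n → Bool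
eqb a b = ⌊ a ≟ b ⌋

DeleteVertex : ∀ {n} → Graph n → Fin n → Graph n → Set
DeleteVertex G v H =
  (vtx G v ≡ true) ×
  (∀ u → vtx H u ≡ (vtx G u ∧ not (eqb u v))) ×
  (∀ a b → edge H a b ≡ (edge G a b ∧ not (eqb a v) ∧ not (eqb b v)))

DeleteBridge : ∀ {n} → Graph n → Fin n → Fin n → Graph n → Set
DeleteBridge G u v H =
  Bridge G u v ×
  (∀ w → vtx H w ≡ vtx G w) ×
  (∀ a b → edge H a b ≡
     (edge G a b ∧ not ((eqb a u ∧ eqb b v) ∨ (eqb a v ∧ eqb b u))))

Step : ∀ {n} → Graph n → Graph n → Set
Step G H = (∃ λ v → DeleteVertex G v H) ⊎ (∃ λ u → ∃ λ v → DeleteBridge G u v H)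

Reachable : ∀ {n} → Graph n → Graph n → Set
Reachable = Star Step

ThreeRemain : ∀ {n} → (Fin n → Bool) → Graph n → Set
ThreeRemain {n} K H = Σ (Fin n) λ a → Σ (Fin n) λ b → Σ (Fin n) λ d →
  (a ≢ b) × (a ≢ d) × (b ≢ d) ×
  (K a ≡ true) × (K b ≡ true) × (K d ≡ true) ×
  (vtx H a ≡ true) × (vtx H b ≡ true) × (vtx H d ≡ true)

-- Every step deletes edges, so a cycle of the smaller graph is a cycle of the
-- larger one, and the only edges that disappear between two present vertices
-- are bridges.  An edge lying on a cycle is therefore never lost.  A chord of a
-- cycle closes up a shorter cycle with an arc of it, so chords survive and
-- chordality is inherited.  Likewise, while three clique vertices remain, every
-- clique edge lies on a triangle, so the clique stays a clique and the
-- restriction of (K, I) is a split partition.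
module Submission where

open import Defs hiding (sym)
open import Data.Nat using (ℕ; zero; suc; _+_; _≤_; _<_; _<?_; s≤s; z≤n)
open import Data.Nat.Properties
  using (+-suc; +-identityʳ; suc-injective; +-cancelˡ-≡; +-monoʳ-≤; ≤-trans; ≤-pred; ≤-antisym; ≮⇒≥; <-cmp; 1+n≢n)
open import Data.Fin using (Fin; zero; suc; toℕ; fromℕ<; fromℕ; _≟_)
open import Data.Fin.Properties using (toℕ-fromℕ<; toℕ-fromℕ; toℕ-injective; toℕ<n)
open import Data.Bool using (Bool; true; false; _∧_; _∨_; not)
open import Data.Product using (Σ; ∃; _×_; _,_)
open import Data.Sum using (_⊎_; inj₁; inj₂)
open import Data.Empty using (⊥-elim)
open import Relation.Nullary using (¬_; yes; no)
open import Relation.Binary using (tri<; tri≈; tri>)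
open import Relation.Binary.PropositionalEquality
  using (_≡_; _≢_; refl; sym; trans; cong; subst; module ≡-Reasoning)
open import Relation.Binary.Construct.Closure.ReflexiveTransitive using (ε; _◅_)

∧-elimˡ : ∀ {a b} → a ∧ b ≡ true → a ≡ true
∧-elimˡ {true} _ = refl

∧-elimʳ : ∀ {a b} → a ∧ b ≡ true → b ≡ true
∧-elimʳ {true} p = p

∧-intro : ∀ {a b} → a ≡ true → b ≡ true → a ∧ b ≡ true
∧-intro refl refl = refl

SameEdge : ∀ {n} → Fin n → Fin n → Fin n → Fin n → Set
SameEdge u v x y = ((u ≡ x) × (v ≡ y)) ⊎ ((u ≡ y) × (v ≡ x))

not-sameEdgeᵇ : ∀ {n} {u v x y : Fin n} → ¬ SameEdge u v x y →
  not ((eqb u x ∧ eqb v y) ∨ (eqb u y ∧ eqb v x)) ≡ true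
not-sameEdgeᵇ {u = u} {v} {x} {y} ¬same with u ≟ x | v ≟ y | u ≟ y | v ≟ x
... | yes p | yes q | _     | _     = ⊥-elim (¬same (inj₁ (p , q)))
... | _     | _     | yes p | yes q = ⊥-elim (¬same (inj₂ (p , q)))
... | no _  | _     | no _  | _     = refl
... | no _  | _     | yes _ | no _  = refl
... | yes _ | no _  | no _  | _     = refl
... | yes _ | no _  | yes _ | no _  = refl

record _⊑_ {n} (H G : Graph n) : Set where
  field
    vtx⊆  : ∀ v → vtx H v ≡ true → vtx G v ≡ true
    edge⊆ : ∀ u v → edge H u v ≡ true → edge G u v ≡ true
open _⊑_

⊑-trans : ∀ {n} {F G H : Graph n} → F ⊑ G → G ⊑ H → F ⊑ H
⊑-trans F⊑G G⊑H = record
  { vtx⊆  = λ v p → vtx⊆ G⊑H v (vtx⊆ F⊑G v p)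
  ; edge⊆ = λ u v p → edge⊆ G⊑H u v (edge⊆ F⊑G u v p)
  }

step-⊑ : ∀ {n} {G H : Graph n} → Step G H → H ⊑ G
step-⊑ (inj₁ (_ , _ , vtx≡ , edge≡)) = record
  { vtx⊆  = λ v p → ∧-elimˡ (trans (sym (vtx≡ v)) p)
  ; edge⊆ = λ u v p → ∧-elimˡ (trans (sym (edge≡ u v)) p)
  }
step-⊑ (inj₂ (_ , _ , _ , vtx≡ , edge≡)) = record
  { vtx⊆  = λ v p → trans (sym (vtx≡ v)) p
  ; edge⊆ = λ u v p → ∧-elimˡ (trans (sym (edge≡ u v)) p)
  }

reachable-⊑ : ∀ {n} {G H : Graph n} → Reachable G H → H ⊑ G
reachable-⊑ ε = record { vtx⊆ = λ _ p → p ; edge⊆ = λ _ _ p → p }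
reachable-⊑ (s ◅ r) = ⊑-trans (reachable-⊑ r) (step-⊑ s)

Consec-sym : ∀ {k a b} → Consec k a b → Consec k b a
Consec-sym (inj₁ p)                 = inj₂ (inj₁ p)
Consec-sym (inj₂ (inj₁ p))          = inj₁ p
Consec-sym (inj₂ (inj₂ (inj₁ p)))   = inj₂ (inj₂ (inj₂ p))
Consec-sym (inj₂ (inj₂ (inj₂ p)))   = inj₂ (inj₂ (inj₁ p))

Consec-irrefl : ∀ {k} a → 2 ≤ k → ¬ Consec k a a
Consec-irrefl a _ (inj₁ p)                              = 1+n≢n p
Consec-irrefl a _ (inj₂ (inj₁ p))                       = 1+n≢n p
Consec-irrefl a (s≤s (s≤s _)) (inj₂ (inj₂ (inj₁ (refl , ()))))
Consec-irrefl a (s≤s (s≤s _)) (inj₂ (inj₂ (inj₂ (refl , ()))))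

cycle-vtx : ∀ {n} {G : Graph n} {k} (C : Cycle G k) (i : Fin k) → vtx G (c C i) ≡ true
cycle-vtx {G = G} {suc k} C i with suc (toℕ i) <? suc k
... | yes i+1<k = edge-vtx G _ _ (adj C i (fromℕ< i+1<k) (inj₁ (sym (toℕ-fromℕ< i+1<k))))
... | no  i+1≮k = edge-vtx G _ _
  (adj C i zero (inj₂ (inj₂ (inj₂ (refl , ≤-antisym (toℕ<n i) (≮⇒≥ i+1≮k))))))

cycle-⊑ : ∀ {n} {G H : Graph n} {k} → H ⊑ G → Cycle H k → Cycle G k
cycle-⊑ H⊑G C = record
  { len≥3 = len≥3 C ; c = c C ; inj = inj C
  ; adj = λ i j p → edge⊆ H⊑G _ _ (adj C i j p) }

record OnCycle {n} (G : Graph n) (u v : Fin n) : Set where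
  field
    {len} : ℕ
    cycle : Cycle G len
    p q   : Fin len
    consec : Consec len (toℕ p) (toℕ q)
    at-p  : c cycle p ≡ u
    at-q  : c cycle q ≡ v

OnCycle-sym : ∀ {n} {G : Graph n} {u v} → OnCycle G u v → OnCycle G v u
OnCycle-sym o = record
  { cycle = cycle ; p = q ; q = p ; consec = Consec-sym consec ; at-p = at-q ; at-q = at-p }
  where open OnCycle o

bridge-∉-cycle : ∀ {n} {G : Graph n} {x y u v} → Bridge G x y → OnCycle G u v → ¬ SameEdge u v x y
bridge-∉-cycle (_ , noCycle) o (inj₁ (u≡x , v≡y)) =
  noCycle _ cycle p q consec (inj₁ (trans at-p u≡x , trans at-q v≡y))
  where open OnCycle o
bridge-∉-cycle (_ , noCycle) o (inj₂ (u≡y , v≡x)) =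
  noCycle _ cycle p q consec (inj₂ (trans at-p u≡y , trans at-q v≡x))
  where open OnCycle o

triangle : ∀ {n} {G : Graph n} {u v w} → u ≢ v → u ≢ w → v ≢ w →
  edge G u v ≡ true → edge G u w ≡ true → edge G v w ≡ true → OnCycle G u v
triangle {G = G} {u} {v} {w} u≢v u≢w v≢w uv uw vw = record
  { cycle = record { len≥3 = s≤s (s≤s (s≤s z≤n)) ; c = t ; inj = λ {i} {j} → t-inj i j ; adj = t-adj }
  ; p = zero ; q = suc zero ; consec = inj₁ refl ; at-p = refl ; at-q = refl }
  where
  t : Fin 3 → Fin _
  t zero             = u
  t (suc zero)       = v
  t (suc (suc zero)) = w

  t-inj : ∀ i j → t i ≡ t j → i ≡ j
  t-inj zero             zero             _ = refl
  t-inj zero             (suc zero)       p = ⊥-elim (u≢v p)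
  t-inj zero             (suc (suc zero)) p = ⊥-elim (u≢w p)
  t-inj (suc zero)       zero             p = ⊥-elim (u≢v (sym p))
  t-inj (suc zero)       (suc zero)       _ = refl
  t-inj (suc zero)       (suc (suc zero)) p = ⊥-elim (v≢w p)
  t-inj (suc (suc zero)) zero             p = ⊥-elim (u≢w (sym p))
  t-inj (suc (suc zero)) (suc zero)       p = ⊥-elim (v≢w (sym p))
  t-inj (suc (suc zero)) (suc (suc zero)) _ = refl

  t-edge : ∀ i j → i ≢ j → edge G (t i) (t j) ≡ true
  t-edge zero             zero             i≢j = ⊥-elim (i≢j refl)
  t-edge zero             (suc zero)       _   = uv
  t-edge zero             (suc (suc zero)) _   = uw
  t-edge (suc zero)       zero             _   = trans (Graph.sym G v u) uv
  t-edge (suc zero)       (suc zero)       i≢j = ⊥-elim (i≢j refl)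
  t-edge (suc zero)       (suc (suc zero)) _   = vw
  t-edge (suc (suc zero)) zero             _   = trans (Graph.sym G w u) uw
  t-edge (suc (suc zero)) (suc zero)       _   = trans (Graph.sym G w v) vw
  t-edge (suc (suc zero)) (suc (suc zero)) i≢j = ⊥-elim (i≢j refl)

  t-adj : ∀ i j → Consec 3 (toℕ i) (toℕ j) → edge G (t i) (t j) ≡ true
  t-adj i j ij = t-edge i j λ { refl → Consec-irrefl (toℕ i) (s≤s (s≤s z≤n)) ij }

-- Positions a, a+1, …, a+e+2 of a cycle C, closed up by an edge between the
-- two ends, form a cycle of length e+3.
module Arc {n} {G : Graph n} {k} (C : Cycle G k) (a e : ℕ) (i j : Fin k)
  (i≡a : toℕ i ≡ a) (j≡a+e+2 : toℕ j ≡ a + suc (suc e))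
  (ij : edge G (c C i) (c C j) ≡ true) where

  len : ℕ
  len = suc (suc (suc e))

  shift : Fin len → Fin k
  shift t = fromℕ< (≤-trans (s≤s (+-monoʳ-≤ a (≤-pred (toℕ<n t))))
                            (subst (λ z → suc z ≤ k) j≡a+e+2 (toℕ<n j)))

  toℕ-shift : ∀ t → toℕ (shift t) ≡ a + toℕ t
  toℕ-shift t = toℕ-fromℕ< _

  shift-first : ∀ t → toℕ t ≡ 0 → shift t ≡ i
  shift-first t t≡0 = toℕ-injective
    (trans (toℕ-shift t) (trans (cong (a +_) t≡0) (trans (+-identityʳ a) (sym i≡a))))

  shift-last : ∀ t → suc (toℕ t) ≡ len → shift t ≡ j
  shift-last t t+1≡len = toℕ-injective
    (trans (toℕ-shift t) (trans (cong (a +_) (suc-injective t+1≡len)) (sym j≡a+e+2)))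

  shift-suc : ∀ t s → suc (toℕ t) ≡ toℕ s → suc (toℕ (shift t)) ≡ toℕ (shift s)
  shift-suc t s t+1≡s = begin
    suc (toℕ (shift t)) ≡⟨ cong suc (toℕ-shift t) ⟩
    suc (a + toℕ t)     ≡⟨ sym (+-suc a (toℕ t)) ⟩
    a + suc (toℕ t)     ≡⟨ cong (a +_) t+1≡s ⟩
    a + toℕ s           ≡⟨ sym (toℕ-shift s) ⟩
    toℕ (shift s)       ∎
    where open ≡-Reasoning

  closing : ∀ t s → toℕ t ≡ 0 → suc (toℕ s) ≡ len → edge G (c C (shift t)) (c C (shift s)) ≡ true
  closing t s t≡0 s+1≡len rewrite shift-first t t≡0 | shift-last s s+1≡len = ij

  arc-adj : ∀ t s → Consec len (toℕ t) (toℕ s) → edge G (c C (shift t)) (c C (shift s)) ≡ true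
  arc-adj t s (inj₁ p)                     = adj C (shift t) (shift s) (inj₁ (shift-suc t s p))
  arc-adj t s (inj₂ (inj₁ p))              = adj C (shift t) (shift s) (inj₂ (inj₁ (shift-suc s t p)))
  arc-adj t s (inj₂ (inj₂ (inj₁ (p , q)))) = closing t s p q
  arc-adj t s (inj₂ (inj₂ (inj₂ (p , q)))) = trans (Graph.sym G _ _) (closing s t p q)

  arc : Cycle G len
  arc = record
    { len≥3 = s≤s (s≤s (s≤s z≤n))
    ; c     = λ t → c C (shift t)
    ; inj   = λ {t} {s} eq → toℕ-injective (+-cancelˡ-≡ a _ _
                (trans (sym (toℕ-shift t)) (trans (cong toℕ (inj C eq)) (toℕ-shift s))))
    ; adj   = arc-adj
    }

  onCycle : OnCycle G (c C i) (c C j)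
  onCycle = record
    { cycle  = arc ; p = zero ; q = fromℕ (suc (suc e))
    ; consec = inj₂ (inj₂ (inj₁ (refl , cong suc (toℕ-fromℕ _))))
    ; at-p   = cong (c C) (shift-first zero refl)
    ; at-q   = cong (c C) (shift-last (fromℕ _) (cong suc (toℕ-fromℕ _)))
    }

gap : ∀ a b → a < b → suc a ≢ b → ∃ λ e → b ≡ a + suc (suc e)
gap zero    (suc zero)    _         a+1≢b = ⊥-elim (a+1≢b refl)
gap zero    (suc (suc e)) _         _     = e , refl
gap (suc a) (suc b)       (s≤s a<b) a+1≢b with gap a b a<b (λ p → a+1≢b (cong suc p))
... | e , b≡ = e , cong suc b≡

chord-onCycle : ∀ {n} {G : Graph n} {k} (C : Cycle G k) (i j : Fin k) → i ≢ j →
  ¬ Consec k (toℕ i) (toℕ j) → edge G (c C i) (c C j) ≡ true → OnCycle G (c C i) (c C j)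
chord-onCycle {G = G} C i j i≢j ¬consec ij with <-cmp (toℕ i) (toℕ j)
... | tri≈ _ i≡j _ = ⊥-elim (i≢j (toℕ-injective i≡j))
... | tri< i<j _ _ with gap (toℕ i) (toℕ j) i<j (λ p → ¬consec (inj₁ p))
...   | e , j≡ = Arc.onCycle C (toℕ i) e i j refl j≡ ij
chord-onCycle {G = G} C i j i≢j ¬consec ij | tri> _ _ j<i
  with gap (toℕ j) (toℕ i) j<i (λ p → ¬consec (inj₂ (inj₁ p)))
... | e , i≡ = OnCycle-sym (Arc.onCycle C (toℕ j) e j i refl i≡ (trans (Graph.sym G _ _) ij))

step-keeps-onCycle : ∀ {n} {G H : Graph n} {u v} → Step G H → edge G u v ≡ true →
  vtx H u ≡ true → vtx H v ≡ true → OnCycle G u v → edge H u v ≡ true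
step-keeps-onCycle {G = G} {u = u} {v} (inj₁ (x , _ , vtx≡ , edge≡)) uv u∈H v∈H _ =
  trans (edge≡ u v) (∧-intro uv (∧-intro (≢-deleted u u∈H) (≢-deleted v v∈H)))
  where
  ≢-deleted : ∀ w → _ → not (eqb w x) ≡ true
  ≢-deleted w w∈H = ∧-elimʳ {vtx G w} (trans (sym (vtx≡ w)) w∈H)
step-keeps-onCycle {u = u} {v} (inj₂ (x , y , bridge , _ , edge≡)) uv _ _ o =
  trans (edge≡ u v) (∧-intro uv (not-sameEdgeᵇ (bridge-∉-cycle bridge o)))

chordal-step : ∀ {n} {G H : Graph n} → Step G H → Chordal G → Chordal H
chordal-step {G = G} {H} s chordal k k≥4 C with chordal k k≥4 (cycle-⊑ (step-⊑ s) C)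
... | i , j , i≢j , ¬consec , ij = i , j , i≢j , ¬consec ,
  step-keeps-onCycle {G = G} {H} s ij (cycle-vtx C i) (cycle-vtx C j)
    (chord-onCycle (cycle-⊑ (step-⊑ s) C) i j i≢j ¬consec ij)

reachable-chordal : ∀ {n} {G H : Graph n} → Reachable G H → Chordal G → Chordal H
reachable-chordal ε       chordal = chordal
reachable-chordal (s ◅ r) chordal = reachable-chordal r (chordal-step s chordal)

CliqueOn : ∀ {n} → (Fin n → Bool) → Graph n → Set
CliqueOn K G = ∀ u v → K u ≡ true → K v ≡ true →
  vtx G u ≡ true → vtx G v ≡ true → u ≢ v → edge G u v ≡ true

ThreeRemain-⊑ : ∀ {n} {K} {G H : Graph n} → H ⊑ G → ThreeRemain K H → ThreeRemain K G
ThreeRemain-⊑ H⊑G (a , b , d , a≢b , a≢d , b≢d , Ka , Kb , Kd , a∈ , b∈ , d∈) =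
  a , b , d , a≢b , a≢d , b≢d , Ka , Kb , Kd , vtx⊆ H⊑G a a∈ , vtx⊆ H⊑G b b∈ , vtx⊆ H⊑G d d∈

avoid-two : ∀ {n} {K} {G : Graph n} (u v : Fin n) → ThreeRemain K G →
  Σ (Fin n) λ w → (K w ≡ true) × (vtx G w ≡ true) × (w ≢ u) × (w ≢ v)
avoid-two u v (a , b , d , a≢b , a≢d , b≢d , Ka , Kb , Kd , a∈ , b∈ , d∈)
  with a ≟ u | a ≟ v | b ≟ u | b ≟ v | d ≟ u | d ≟ v
... | no a≢u | no a≢v | _ | _ | _ | _ = a , Ka , a∈ , a≢u , a≢v
... | _ | _ | no b≢u | no b≢v | _ | _ = b , Kb , b∈ , b≢u , b≢v
... | _ | _ | _ | _ | no d≢u | no d≢v = d , Kd , d∈ , d≢u , d≢v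
... | yes refl | _ | yes refl | _ | _ | _ = ⊥-elim (a≢b refl)
... | _ | yes refl | _ | yes refl | _ | _ = ⊥-elim (a≢b refl)
... | yes refl | _ | _ | _ | yes refl | _ = ⊥-elim (a≢d refl)
... | _ | yes refl | _ | _ | _ | yes refl = ⊥-elim (a≢d refl)
... | _ | _ | yes refl | _ | yes refl | _ = ⊥-elim (b≢d refl)
... | _ | _ | _ | yes refl | _ | yes refl = ⊥-elim (b≢d refl)

clique-step : ∀ {n} {K} {G H : Graph n} → Step G H → ThreeRemain K H → CliqueOn K G → CliqueOn K H
clique-step {G = G} {H} s three clique u v Ku Kv u∈H v∈H u≢v
  with avoid-two {G = G} u v (ThreeRemain-⊑ (step-⊑ {G = G} {H} s) three)
... | w , Kw , w∈G , w≢u , w≢v =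
  step-keeps-onCycle {G = G} {H} s uv u∈H v∈H
    (triangle u≢v (λ u≡w → w≢u (sym u≡w)) (λ v≡w → w≢v (sym v≡w)) uv
      (clique u w Ku Kw u∈G w∈G (λ u≡w → w≢u (sym u≡w)))
      (clique v w Kv Kw v∈G w∈G (λ v≡w → w≢v (sym v≡w))))
  where
  H⊑G : H ⊑ G
  H⊑G = step-⊑ s
  u∈G : vtx G u ≡ true
  u∈G = vtx⊆ H⊑G u u∈H
  v∈G : vtx G v ≡ true
  v∈G = vtx⊆ H⊑G v v∈H
  uv : edge G u v ≡ true
  uv = clique u v Ku Kv u∈G v∈G u≢v

reachable-clique : ∀ {n} {K} {G H : Graph n} → Reachable G H → ThreeRemain K H → CliqueOn K G → CliqueOn K H
reachable-clique ε       _     clique = clique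
reachable-clique {G = G} (_◅_ {j = M} s r) three clique =
  reachable-clique r three (clique-step {G = G} {M} s (ThreeRemain-⊑ (reachable-⊑ r) three) clique)

non-edge-⊑ : ∀ {n} {G H : Graph n} → H ⊑ G → ∀ u v → edge G u v ≡ false → edge H u v ≡ false
non-edge-⊑ {H = H} H⊑G u v uv∉G with edge H u v in uv∈H
... | false = refl
... | true  with () ← trans (sym uv∉G) (edge⊆ H⊑G u v uv∈H)

restrict-split : ∀ {n} {K I} {G H : Graph n} → SplitPartition G K I → H ⊑ G → CliqueOn K H →
  SplitPartition H (λ v → K v ∧ vtx H v) (λ v → I v ∧ vtx H v)
restrict-split {K = K} {I} {H = H} split H⊑G clique = record
  { K-vtx  = λ _ → ∧-elimʳ
  ; I-vtx  = λ _ → ∧-elimʳ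
  ; cover  = cover′
  ; disj   = λ v Kv Iv → disj v (∧-elimˡ Kv) (∧-elimˡ Iv)
  ; clique = λ u v Ku Kv → clique u v (∧-elimˡ Ku) (∧-elimˡ Kv) (∧-elimʳ Ku) (∧-elimʳ Kv)
  ; indep  = λ u v Iu Iv → non-edge-⊑ H⊑G u v (indep u v (∧-elimˡ Iu) (∧-elimˡ Iv))
  }
  where
  open SplitPartition split using (cover; disj; indep)
  cover′ : ∀ v → vtx H v ≡ true → (K v ∧ vtx H v ≡ true) ⊎ (I v ∧ vtx H v ≡ true)
  cover′ v v∈H with cover v (vtx⊆ H⊑G v v∈H)
  ... | inj₁ Kv = inj₁ (∧-intro Kv v∈H)
  ... | inj₂ Iv = inj₂ (∧-intro Iv v∈H)

corollary2 : ∀ {n} (G H : Graph n) → Full G → Reachable G H →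
    (Chordal G → Chordal H) ×
    (∀ (K I : Fin n → Bool) → SplitPartition G K I → ThreeRemain K H → Split H)
corollary2 G H _ G↝H = reachable-chordal G↝H , split
  where
  split : ∀ K I → SplitPartition G K I → ThreeRemain K H → Split H
  split K I partition three = _ , _ , restrict-split partition (reachable-⊑ G↝H)
    (reachable-clique G↝H three (λ u v Ku Kv _ _ → SplitPartition.clique partition u v Ku Kv))
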